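{- Let $k\ge1$ be an integer and let $G=(V,E)$ be a bipartite graph with $n=|V|$ vertices. Set $G_0=G$ and, for $i=1,\dots,k$, let $M^{(i)}$ be an arbitrary maximum-cardinality matching of $G_{i-1}$ and let $G_i$ be the graph obtained from $G_{i-1}$ by deleting the edges of $M^{(i)}$ (keeping all vertices). Let $\mathcal{M}_k=M^{(1)}\cup\cdots\cup M^{(k)}$, and let $I_k$ be a maximum independent set of $G_k$. Then $$|I_k|\ge n-\frac{|\mathcal{M}_k|}{k}.$$
   Context: All graphs are simple and undirected. A matching is a set of edges no two of which share an end-vertex. -}

module Defs where

open import Data.Nat using (ℕ; _≤_)
open import Data.Fin using (Fin)
open import Data.Fin.Subset using (Subset; _∈_)
open import Data.Bool using (Bool)
open import Data.Product using (_×_; _,_; ∃; proj₁; proj₂)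
open import Data.Sum using (_⊎_; inj₁; inj₂)
open import Data.List using (List; []; _∷_; length; lookup)
open import Data.List.Relation.Unary.All using (All)
open import Data.List.Relation.Unary.Any using (Any)
open import Data.List.Relation.Unary.Any.Properties using () renaming (map⁺ to any-map⁺)
open import Relation.Nullary using (¬_)
open import Relation.Binary.PropositionalEquality using (_≡_; _≢_; refl)

record Graph (n : ℕ) : Set₁ where
  field
    Adj    : Fin n → Fin n → Set
    sym    : ∀ {u v} → Adj u v → Adj v u
    irrefl : ∀ {u} → ¬ Adj u u
open Graph public

Bipartite : ∀ {n} → Graph n → Set
Bipartite {n} G = ∃ λ (c : Fin n → Bool) → ∀ {u v} → Adj G u v → c u ≢ c v

-- an edge {u,v} is stored as a pair (u , v) in either orientation
Edge : ℕ → Set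
Edge n = Fin n × Fin n

EdgeIn : ∀ {n} → Fin n → Fin n → List (Edge n) → Set
EdgeIn u v M = Any (λ e → (e ≡ (u , v)) ⊎ (e ≡ (v , u))) M

EdgeIn-sym : ∀ {n} {u v : Fin n} {M} → EdgeIn u v M → EdgeIn v u M
EdgeIn-sym = Data.List.Relation.Unary.Any.map λ { (inj₁ p) → inj₂ p ; (inj₂ p) → inj₁ p }

VertexDisjoint : ∀ {n} → Edge n → Edge n → Set
VertexDisjoint (a , b) (c , d) = (a ≢ c) × (a ≢ d) × (b ≢ c) × (b ≢ d)

-- a matching of G: a list of edges of G, no two (distinct positions) sharing an end-vertex.
-- (This also forces the listed edges to be distinct, so |M| = length M.)
IsMatching : ∀ {n} → Graph n → List (Edge n) → Set
IsMatching G M =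
  All (λ e → Adj G (proj₁ e) (proj₂ e)) M ×
  (∀ (i j : Fin (length M)) → i ≢ j → VertexDisjoint (lookup M i) (lookup M j))

IsMaximumMatching : ∀ {n} → Graph n → List (Edge n) → Set
IsMaximumMatching G M = IsMatching G M × (∀ M' → IsMatching G M' → length M' ≤ length M)

deleteEdges : ∀ {n} → Graph n → List (Edge n) → Graph n
deleteEdges G M = record
  { Adj    = λ u v → Adj G u v × ¬ EdgeIn u v M
  ; sym    = λ { (a , nm) → sym G a , λ m → nm (EdgeIn-sym m) }
  ; irrefl = λ { (a , _) → irrefl G a }
  }

deleteAll : ∀ {n} → Graph n → List (List (Edge n)) → Graph n
deleteAll G []       = G
deleteAll G (M ∷ Ms) = deleteAll (deleteEdges G M) Ms

data PeelingSequence {n} : Graph n → List (List (Edge n)) → Set₁ where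
  []  : ∀ {G} → PeelingSequence G []
  _∷_ : ∀ {G M Ms} → IsMaximumMatching G M →
        PeelingSequence (deleteEdges G M) Ms → PeelingSequence G (M ∷ Ms)

IsIndependent : ∀ {n} → Graph n → Subset n → Set
IsIndependent G I = ∀ {u v} → u ∈ I → v ∈ I → ¬ Adj G u v

IsMaximumIndependent : ∀ {n} → Graph n → Subset n → Set
IsMaximumIndependent {n} G I =
  IsIndependent G I × (∀ (J : Subset n) → IsIndependent G J → Data.Fin.Subset.∣ J ∣ ≤ Data.Fin.Subset.∣ I ∣)

{-# OPTIONS --safe #-}
-- Let ν be the matching number of Gₖ. Since Gₖ is a subgraph of every G_{i-1}, each maximum
-- matching M⁽ⁱ⁾ has at least ν edges, so |𝓜ₖ| ≥ kν. Gₖ is bipartite, so by König's theorem it has a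
-- vertex cover of size ν, whose complement is an independent set of size n - ν; hence
-- k|Iₖ| ≥ k(n - ν) ≥ kn - |𝓜ₖ|. König's theorem is proved by alternating paths: for a maximum
-- matching M, the left vertices not reachable from M-free left vertices, together with the right
-- neighbours of reachable ones, form a cover meeting every edge of M exactly once.
-- A maximum matching of Gₖ and the cover as a subset are only obtained under double negation,
-- which is harmless because the final inequality between natural numbers is decidable.
module Submission where

open import Defs
open import Data.Nat using (ℕ; _≤_; _*_; _+_; _≥_)
open import Data.Fin.Subset using (Subset; ∣_∣)
open import Data.List using (List; length; concat)

open import Level using (0ℓ)
open import Data.Nat using (zero; suc; _<_; z≤n; s≤s; _≤?_)
open import Data.Nat.Properties
  using (≤-refl; ≤-reflexive; n≤1+n; ≤-trans; ≮⇒≥; <-irrefl; n≮n; m≤m+n; +-suc; m∸n+n≡m;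
         +-mono-≤; +-monoʳ-≤; *-monoʳ-≤; *-distribˡ-+; module ≤-Reasoning)
open import Data.Fin using (Fin; _≟_)
open import Data.Fin.Subset using (_∈_; _∉_; _-_; ∁; inside; outside)
open import Data.Fin.Subset.Properties
  using (_∈?_; ∣p∣≤n; ∣∁p∣≡n∸∣p∣; p─⊥≡p; p─q⊆p; Empty-unique; ∣⊥∣≡0; x∈∁p⇒x∉p)
open import Data.Bool using (Bool; true; false; not)
open import Data.Bool.Properties using (¬-not)
open import Data.Vec using ([]; _∷_; here; there)
open import Data.Empty using (⊥; ⊥-elim)
open import Data.Product using (_×_; _,_; ∃; proj₁; proj₂)
open import Data.Sum using (_⊎_; inj₁; inj₂; [_,_])
open import Data.List using ([]; _∷_; _++_; lookup; tabulate)
open import Data.List.Properties using (length-++; length-removeAt′; tabulate-lookup)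
open import Data.List.Relation.Unary.All as All using (All; []; _∷_)
open import Data.List.Relation.Unary.All.Properties using (─⁺; ¬Any⇒All¬)
open import Data.List.Relation.Unary.Any as Any using (Any; here; there; _─_; any?)
open import Data.List.Relation.Unary.Any.Properties using (lookup-result; ¬Any[])
open import Data.List.Relation.Unary.AllPairs using (AllPairs; []; _∷_)
import Data.List.Relation.Unary.AllPairs.Properties as AllPairs
open import Data.List.Membership.Propositional using () renaming (_∈_ to _∈ᴸ_; _∉_ to _∉ᴸ_)
open import Data.List.Membership.Propositional.Properties using (∈-lookup)
open import Function using (_∘_; flip; _⇔_; mk⇔; Equivalence)
open import Relation.Binary.Definitions using (Symmetric)
open import Relation.Nullary using (¬_; Dec; yes; no; contradiction)
open import Relation.Nullary.Decidable using (decidable-stable; _⊎-dec_)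
open import Relation.Nullary.Decidable.Core using (¬¬-excluded-middle)
open import Relation.Nullary.Negation using (¬¬-Monad)
open import Effect.Monad using (RawMonad)
open import Relation.Binary.PropositionalEquality using (_≡_; _≢_; refl; trans; cong; subst; ≢-sym)
import Relation.Binary.PropositionalEquality as ≡

open RawMonad (¬¬-Monad {a = 0ℓ}) using (_>>=_; pure)

¬¬-comprehension : ∀ {n} (P : Fin n → Set) → ¬ ¬ (∃ λ (S : Subset n) → ∀ v → v ∈ S ⇔ P v)
¬¬-comprehension {zero} P = pure ([] , λ ())
¬¬-comprehension {suc n} P = do
  P₀? ← ¬¬-excluded-middle
  (S , S⇔P) ← ¬¬-comprehension (P ∘ Fin.suc)
  pure (proj₁ (head P₀?) ∷ S , λ { Fin.zero → proj₂ (head P₀?) ; (Fin.suc v) → tail (S⇔P v) })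
  where
  head : Dec (P Fin.zero) → ∃ λ s → ∀ {S : Subset n} → Fin.zero ∈ s ∷ S ⇔ P Fin.zero
  head (yes p)  = inside  , mk⇔ (λ _ → p) (λ _ → here)
  head (no ¬p)  = outside , mk⇔ (λ ()) (λ p → contradiction p ¬p)

  tail : ∀ {s} {S : Subset n} {v} → v ∈ S ⇔ P (Fin.suc v) → Fin.suc v ∈ s ∷ S ⇔ P (Fin.suc v)
  tail v∈S⇔P = mk⇔ (λ { (there v∈S) → Equivalence.to v∈S⇔P v∈S }) (there ∘ Equivalence.from v∈S⇔P)

¬¬-maximum : ∀ {A : Set} (P : A → Set) (size : A → ℕ) (bound : ℕ) →
             (∀ x → P x → size x ≤ bound) → ∀ {x} → P x →
             ¬ ¬ (∃ λ m → P m × ∀ y → P y → size y ≤ size m)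
¬¬-maximum {A} P size bound bounded {x₀} Px₀ = search bound x₀ Px₀ (m≤m+n bound (size x₀))
  where
  Maximum : Set
  Maximum = ∃ λ m → P m × ∀ y → P y → size y ≤ size m

  search  : (fuel : ℕ) (x : A) → P x → bound ≤ fuel + size x → ¬ ¬ Maximum
  improve : (fuel : ℕ) (x : A) → P x → bound ≤ fuel + size x →
            Dec (∃ λ y → P y × size x < size y) → ¬ ¬ Maximum

  search fuel x Px enough = ¬¬-excluded-middle >>= improve fuel x Px enough

  improve _ x Px _ (no none) = pure (x , Px , λ y Py → ≮⇒≥ (λ x<y → none (y , Py , x<y)))
  improve zero x _ enough (yes (y , Py , x<y)) =
    contradiction (≤-trans x<y (≤-trans (bounded y Py) enough)) (<-irrefl refl)
  improve (suc fuel) x _ enough (yes (y , Py , x<y)) =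
    search fuel y Py (≤-trans enough (subst (_≤ fuel + size y) (+-suc fuel (size x)) (+-monoʳ-≤ fuel x<y)))

module _ {A : Set} {P Q : A → Set} where

  Any-─⁻ : ∀ {xs} (p : Any P xs) → Any Q (xs ─ p) → Any Q xs
  Any-─⁻ (here _)  q         = there q
  Any-─⁻ (there p) (here q)  = here q
  Any-─⁻ (there p) (there q) = there (Any-─⁻ p q)

  Any-─⁺ : ∀ {xs} (p : Any P xs) → Any Q xs → ¬ Q (Any.lookup p) → Any Q (xs ─ p)
  Any-─⁺ (here _)  (here q)  ¬q = contradiction q ¬q
  Any-─⁺ (here _)  (there q) ¬q = q
  Any-─⁺ (there p) (here q)  ¬q = here q
  Any-─⁺ (there p) (there q) ¬q = there (Any-─⁺ p q ¬q)

module _ {A : Set} {R : A → A → Set} where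

  AllPairs-─⁺ : ∀ {P : A → Set} {xs} (p : Any P xs) → AllPairs R xs → AllPairs R (xs ─ p)
  AllPairs-─⁺ (here _)  (_ ∷ rs) = rs
  AllPairs-─⁺ (there p) (r ∷ rs) = ─⁺ p r ∷ AllPairs-─⁺ p rs

  AllPairs-lookup-─ : ∀ {P : A → Set} → Symmetric R → ∀ {xs} (p : Any P xs) →
                      AllPairs R xs → All (R (Any.lookup p)) (xs ─ p)
  AllPairs-lookup-─ R-sym (here _)  (r ∷ _)  = r
  AllPairs-lookup-─ R-sym (there p) (r ∷ rs) =
    R-sym (proj₁ (All.lookupAny r p)) ∷ AllPairs-lookup-─ R-sym p rs

  AllPairs-lookup : Symmetric R → ∀ {xs} → AllPairs R xs →
                    ∀ i j → i ≢ j → R (lookup xs i) (lookup xs j)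
  AllPairs-lookup R-sym (r ∷ rs) Fin.zero    Fin.zero    i≢j = contradiction refl i≢j
  AllPairs-lookup R-sym (r ∷ rs) Fin.zero    (Fin.suc j) _   = All.lookup r (∈-lookup j)
  AllPairs-lookup R-sym (r ∷ rs) (Fin.suc i) Fin.zero    _   = R-sym (All.lookup r (∈-lookup i))
  AllPairs-lookup R-sym (r ∷ rs) (Fin.suc i) (Fin.suc j) i≢j = AllPairs-lookup R-sym rs i j (i≢j ∘ cong Fin.suc)

x∉p-x : ∀ {n} (p : Subset n) x → x ∉ p - x
x∉p-x (_ ∷ p) Fin.zero    ()
x∉p-x (_ ∷ p) (Fin.suc x) (there x∈p-x) = x∉p-x p x x∈p-x

∣p∣≤1+∣p-x∣ : ∀ {n} (p : Subset n) x → ∣ p ∣ ≤ suc ∣ p - x ∣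
∣p∣≤1+∣p-x∣ (inside  ∷ p) Fin.zero    = subst (λ q → suc ∣ p ∣ ≤ suc ∣ q ∣) (≡.sym (p─⊥≡p p)) ≤-refl
∣p∣≤1+∣p-x∣ (outside ∷ p) Fin.zero    = subst (λ q → ∣ p ∣ ≤ suc ∣ q ∣) (≡.sym (p─⊥≡p p)) (n≤1+n _)
∣p∣≤1+∣p-x∣ (inside  ∷ p) (Fin.suc x) = s≤s (∣p∣≤1+∣p-x∣ p x)
∣p∣≤1+∣p-x∣ (outside ∷ p) (Fin.suc x) = ∣p∣≤1+∣p-x∣ p x

∣∁p∣+∣p∣≡n : ∀ {n} (p : Subset n) → ∣ ∁ p ∣ + ∣ p ∣ ≡ n
∣∁p∣+∣p∣≡n p = trans (cong (_+ ∣ p ∣) (∣∁p∣≡n∸∣p∣ p)) (m∸n+n≡m (∣p∣≤n p))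

module _ {n : ℕ} where

  Touches : Fin n → Edge n → Set
  Touches v e = v ≡ proj₁ e ⊎ v ≡ proj₂ e

  Covered : Fin n → List (Edge n) → Set
  Covered v N = Any (Touches v) N

  Joins : Fin n → Fin n → Edge n → Set
  Joins u v e = e ≡ (u , v) ⊎ e ≡ (v , u)

  joins⇒touches₁ : ∀ {u v e} → Joins u v e → Touches u e
  joins⇒touches₁ (inj₁ refl) = inj₁ refl
  joins⇒touches₁ (inj₂ refl) = inj₂ refl

  joins⇒touches₂ : ∀ {u v e} → Joins u v e → Touches v e
  joins⇒touches₂ (inj₁ refl) = inj₂ refl
  joins⇒touches₂ (inj₂ refl) = inj₁ refl

  touches∧joins⇒≡⊎≡ : ∀ {w u v e} → Touches w e → Joins u v e → w ≡ u ⊎ w ≡ v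
  touches∧joins⇒≡⊎≡ (inj₁ refl) (inj₁ refl) = inj₁ refl
  touches∧joins⇒≡⊎≡ (inj₂ refl) (inj₁ refl) = inj₂ refl
  touches∧joins⇒≡⊎≡ (inj₁ refl) (inj₂ refl) = inj₂ refl
  touches∧joins⇒≡⊎≡ (inj₂ refl) (inj₂ refl) = inj₁ refl

  joins-functional : ∀ {u x y e} → Joins u x e → Joins u y e → x ≡ y
  joins-functional (inj₁ refl) (inj₁ refl) = refl
  joins-functional (inj₁ refl) (inj₂ refl) = refl
  joins-functional (inj₂ refl) (inj₁ refl) = refl
  joins-functional (inj₂ refl) (inj₂ refl) = refl

  EdgeIn⇒Covered₁ : ∀ {u v N} → EdgeIn u v N → Covered u N
  EdgeIn⇒Covered₁ = Any.map joins⇒touches₁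

  EdgeIn⇒Covered₂ : ∀ {u v N} → EdgeIn u v N → Covered v N
  EdgeIn⇒Covered₂ = Any.map joins⇒touches₂

  VertexDisjoint-sym : Symmetric (VertexDisjoint {n})
  VertexDisjoint-sym {_ , _} {_ , _} (ac , ad , bc , bd) = ≢-sym ac , ≢-sym bc , ≢-sym ad , ≢-sym bd

  VertexDisjoint⇒¬Touches : ∀ {v} e f → VertexDisjoint e f → Touches v e → ¬ Touches v f
  VertexDisjoint⇒¬Touches _ _ (ac , _ , _ , _) (inj₁ refl) (inj₁ refl) = ac refl
  VertexDisjoint⇒¬Touches _ _ (_ , ad , _ , _) (inj₁ refl) (inj₂ refl) = ad refl
  VertexDisjoint⇒¬Touches _ _ (_ , _ , bc , _) (inj₂ refl) (inj₁ refl) = bc refl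
  VertexDisjoint⇒¬Touches _ _ (_ , _ , _ , bd) (inj₂ refl) (inj₂ refl) = bd refl

  ¬Touches⇒VertexDisjoint : ∀ {x y} f → ¬ Touches x f → ¬ Touches y f → VertexDisjoint (x , y) f
  ¬Touches⇒VertexDisjoint _ ¬x ¬y = ¬x ∘ inj₁ , ¬x ∘ inj₂ , ¬y ∘ inj₁ , ¬y ∘ inj₂

  EdgesOf : Graph n → List (Edge n) → Set
  EdgesOf G N = All (λ e → Adj G (proj₁ e) (proj₂ e)) N

  EdgeIn⇒Adj : ∀ {G u v N} → EdgesOf G N → EdgeIn u v N → Adj G u v
  EdgeIn⇒Adj         (uv ∷ _) (here (inj₁ refl)) = uv
  EdgeIn⇒Adj {G = G} (vu ∷ _) (here (inj₂ refl)) = Graph.sym G vu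
  EdgeIn⇒Adj {G = G} (_ ∷ es) (there e)          = EdgeIn⇒Adj {G = G} es e

  IsPairwiseMatching : Graph n → List (Edge n) → Set
  IsPairwiseMatching G N = EdgesOf G N × AllPairs VertexDisjoint N

  IsMatching⇒IsPairwiseMatching : ∀ {G N} → IsMatching G N → IsPairwiseMatching G N
  IsMatching⇒IsPairwiseMatching {N = N} (edges , disjoint) =
    edges , subst (AllPairs VertexDisjoint) (tabulate-lookup N) (AllPairs.tabulate⁺ (disjoint _ _))

  IsPairwiseMatching⇒IsMatching : ∀ {G N} → IsPairwiseMatching G N → IsMatching G N
  IsPairwiseMatching⇒IsMatching (edges , disjoint) = edges , AllPairs-lookup VertexDisjoint-sym disjoint

  mate-unique : ∀ {N u x y} → AllPairs VertexDisjoint N → EdgeIn u x N → EdgeIn u y N → x ≡ y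
  mate-unique (_ ∷ _)  (here ux)  (here uy)  = joins-functional ux uy
  mate-unique (ds ∷ _) (here ux)  (there uy) with All.lookupAny ds uy
  ... | disjoint , uy′ = contradiction (joins⇒touches₁ uy′) (VertexDisjoint⇒¬Touches _ _ disjoint (joins⇒touches₁ ux))
  mate-unique (ds ∷ _) (there ux) (here uy)  with All.lookupAny ds ux
  ... | disjoint , ux′ = contradiction (joins⇒touches₁ ux′) (VertexDisjoint⇒¬Touches _ _ disjoint (joins⇒touches₁ uy))
  mate-unique (_ ∷ dss) (there ux) (there uy) = mate-unique dss ux uy

  covered-tail : ∀ {v x y N} → Covered v ((x , y) ∷ N) → v ≢ x → v ≢ y → Covered v N
  covered-tail (here (inj₁ v≡x)) v≢x _   = contradiction v≡x v≢x
  covered-tail (here (inj₂ v≡y)) _   v≢y = contradiction v≡y v≢y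
  covered-tail (there v∈N)       _   _   = v∈N

  ∣C∣≤length : ∀ (C : Subset n) N → (∀ {v} → v ∈ C → Covered v N) →
               All (λ e → proj₁ e ∈ C → proj₂ e ∉ C) N → ∣ C ∣ ≤ length N
  ∣C∣≤length C [] covered _ =
    ≤-reflexive (trans (cong ∣_∣ (Empty-unique λ (_ , v∈C) → ¬Any[] (covered v∈C))) (∣⊥∣≡0 n))
  ∣C∣≤length C ((x , y) ∷ N) covered (once ∷ onces) = drop-an-end (y ∈? C)
    where
    shrink : ∀ z → (∀ {v} → v ∈ C → v ≢ z → Covered v N) → ∣ C ∣ ≤ suc (length N)
    shrink z covered′ = ≤-trans (∣p∣≤1+∣p-x∣ C z) (s≤s (∣C∣≤length (C - z) N
      (λ v∈C-z → covered′ (p─q⊆p C _ v∈C-z) λ { refl → x∉p-x C z v∈C-z })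
      (All.map (λ once′ x∈ y∈ → once′ (p─q⊆p C _ x∈) (p─q⊆p C _ y∈)) onces)))

    drop-an-end : Dec (y ∈ C) → ∣ C ∣ ≤ suc (length N)
    drop-an-end (yes y∈C) = shrink y λ v∈C v≢y → covered-tail (covered v∈C) (λ { refl → once v∈C y∈C }) v≢y
    drop-an-end (no  y∉C) = shrink x λ v∈C v≢x → covered-tail (covered v∈C) v≢x (λ { refl → y∉C v∈C })

deleteAll-Adj⇒Adj : ∀ {n} (G : Graph n) Ms {u v} → Adj (deleteAll G Ms) u v → Adj G u v
deleteAll-Adj⇒Adj G []       uv = uv
deleteAll-Adj⇒Adj G (M ∷ Ms) uv = proj₁ (deleteAll-Adj⇒Adj (deleteEdges G M) Ms uv)

deleteAll-IsMatching : ∀ {n} (G : Graph n) Ms {N} → IsMatching (deleteAll G Ms) N → IsMatching G N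
deleteAll-IsMatching G Ms (edges , disjoint) = All.map (deleteAll-Adj⇒Adj G Ms) edges , disjoint

deleteAll-Bipartite : ∀ {n} (G : Graph n) Ms → Bipartite G → Bipartite (deleteAll G Ms)
deleteAll-Bipartite G Ms (c , proper) = c , proper ∘ deleteAll-Adj⇒Adj G Ms

IsVertexCover : ∀ {n} → Graph n → Subset n → Set
IsVertexCover G C = ∀ {u v} → Adj G u v → u ∈ C ⊎ v ∈ C

∁-vertexCover-independent : ∀ {n} {G : Graph n} {C} → IsVertexCover G C → IsIndependent G (∁ C)
∁-vertexCover-independent cover u∈∁C v∈∁C uv =
  [ x∈∁p⇒x∉p u∈∁C , x∈∁p⇒x∉p v∈∁C ] (cover uv)

module AlternatingPaths {n : ℕ} (H : Graph n) (c : Fin n → Bool) (proper : ∀ {u v} → Adj H u v → c u ≢ c v)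
             {M : List (Edge n)} (M-maximum : IsMaximumMatching H M) where

  open import Data.List.Membership.DecPropositional (_≟_ {n}) using () renaming (_∈?_ to _∈ᴸ?_)

  M-matching : IsPairwiseMatching H M
  M-matching = IsMatching⇒IsPairwiseMatching {G = H} (proj₁ M-maximum)

  Left Right : Fin n → Set
  Left  v = c v ≡ false
  Right v = c v ≡ true

  opposite-colours : ∀ {u v} → Adj H u v → c v ≡ not (c u)
  opposite-colours uv = ¬-not (≢-sym (proper uv))

  left⇒right : ∀ {u v} → Adj H u v → Left u → Right v
  left⇒right uv u-left = trans (opposite-colours uv) (cong not u-left)

  right⇒left : ∀ {u v} → Adj H u v → Right u → Left v
  right⇒left uv u-right = trans (opposite-colours uv) (cong not u-right)

  left≢right : ∀ {u v} → Left u → Right v → u ≢ v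
  left≢right u-left v-right refl with trans (≡.sym u-left) v-right
  ... | ()

  mate-adj : ∀ {u v} → EdgeIn u v M → Adj H u v
  mate-adj = EdgeIn⇒Adj {G = H} (proj₁ M-matching)

  -- V lists the right vertices of the path; requiring them distinct keeps the path simple.
  data AltPath : Fin n → List (Fin n) → Set where
    start : ∀ {a} → Left a → ¬ Covered a M → AltPath a []
    step  : ∀ {a′ b a V} → AltPath a′ V → Adj H a′ b → b ∉ᴸ V → EdgeIn b a M → AltPath a (b ∷ V)

  Reachable : Fin n → Set
  Reachable a = ∃ (AltPath a)

  altPath-left : ∀ {a V} → AltPath a V → Left a
  altPath-left (start a-left _)   = a-left
  altPath-left (step path a′b _ ba) = right⇒left (mate-adj ba) (left⇒right a′b (altPath-left path))

  -- The matching M Δ P obtained by switching M along an alternating path P ending at a.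
  record Switched (a : Fin n) (V : List (Fin n)) : Set where
    field
      N          : List (Edge n)
      matching   : IsPairwiseMatching H N
      same-size  : length N ≡ length M
      end-free   : ¬ Covered a N
      keeps-mate : ∀ {b x} → Right b → b ∉ᴸ V → EdgeIn b x M → EdgeIn b x N
      keeps-free : ∀ {b} → Right b → ¬ Covered b M → ¬ Covered b N

  switch : ∀ {a V} → AltPath a V → Switched a V
  switch (start _ a-free) = record
    { N = M ; matching = M-matching ; same-size = refl ; end-free = a-free
    ; keeps-mate = λ _ _ bx → bx ; keeps-free = λ _ b-free → b-free }
  switch {a} {b ∷ V} (step {a′} path a′b b∉V ba∈M) = record
    { N          = (a′ , b) ∷ rest
    ; matching   = a′b ∷ ─⁺ ba∈N (proj₁ S.matching) , new-disjoint ∷ AllPairs-─⁺ ba∈N (proj₂ S.matching)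
    ; same-size  = trans (≡.sym (length-removeAt′ S.N (Any.index ba∈N))) S.same-size
    ; end-free   = end-free
    ; keeps-mate = keeps-mate
    ; keeps-free = keeps-free
    }
    where
    module S = Switched (switch path)

    b-right : Right b
    b-right = left⇒right a′b (altPath-left path)

    a-left : Left a
    a-left = right⇒left (mate-adj ba∈M) b-right

    ba∈N : EdgeIn b a S.N
    ba∈N = S.keeps-mate b-right b∉V ba∈M

    rest : List (Edge n)
    rest = S.N ─ ba∈N

    removed-joins : Joins b a (Any.lookup ba∈N)
    removed-joins = lookup-result ba∈N

    rest-disjoint : All (VertexDisjoint (Any.lookup ba∈N)) rest
    rest-disjoint = AllPairs-lookup-─ VertexDisjoint-sym ba∈N (proj₂ S.matching)

    ¬touches-removed : ∀ {v} → Touches v (Any.lookup ba∈N) → ¬ Covered v rest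
    ¬touches-removed v-removed v-rest with All.lookupAny rest-disjoint v-rest
    ... | disjoint , v-f = VertexDisjoint⇒¬Touches _ _ disjoint v-removed v-f

    new-disjoint : All (VertexDisjoint (a′ , b)) rest
    new-disjoint = All.zipWith (λ { {f} (¬a′ , ¬b) → ¬Touches⇒VertexDisjoint f ¬a′ ¬b })
      ( ¬Any⇒All¬ rest (S.end-free ∘ Any-─⁻ ba∈N)
      , ¬Any⇒All¬ rest (¬touches-removed (joins⇒touches₁ removed-joins)) )

    end-free : ¬ Covered a ((a′ , b) ∷ rest)
    end-free (here (inj₁ refl)) = S.end-free (EdgeIn⇒Covered₂ ba∈N)
    end-free (here (inj₂ refl)) = left≢right a-left b-right refl
    end-free (there a-rest)     = ¬touches-removed (joins⇒touches₂ removed-joins) a-rest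

    keeps-mate : ∀ {b₂ x} → Right b₂ → b₂ ∉ᴸ b ∷ V → EdgeIn b₂ x M → EdgeIn b₂ x ((a′ , b) ∷ rest)
    keeps-mate b₂-right b₂∉ b₂x = there (Any-─⁺ ba∈N (S.keeps-mate b₂-right (b₂∉ ∘ there) b₂x) not-removed)
      where
      not-removed : ¬ Joins _ _ (Any.lookup ba∈N)
      not-removed b₂x-removed with touches∧joins⇒≡⊎≡ (joins⇒touches₁ b₂x-removed) removed-joins
      ... | inj₁ refl = b₂∉ (here refl)
      ... | inj₂ refl = left≢right a-left b₂-right refl

    keeps-free : ∀ {b₂} → Right b₂ → ¬ Covered b₂ M → ¬ Covered b₂ ((a′ , b) ∷ rest)
    keeps-free b₂-right _       (here (inj₁ refl)) = left≢right (altPath-left path) b₂-right refl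
    keeps-free _        b-free  (here (inj₂ refl)) = b-free (EdgeIn⇒Covered₁ ba∈M)
    keeps-free b₂-right b₂-free (there b₂-rest)    = S.keeps-free b₂-right b₂-free (Any-─⁻ ba∈N b₂-rest)

  no-augmenting-path : ∀ {a V b} → AltPath a V → Adj H a b → ¬ Covered b M → ⊥
  no-augmenting-path {a} {b = b} path ab b-free =
    n≮n (length M) (subst (λ k → suc k ≤ length M) S.same-size longer)
    where
    module S = Switched (switch path)

    augmented : IsPairwiseMatching H ((a , b) ∷ S.N)
    augmented = ab ∷ proj₁ S.matching
              , All.zipWith (λ { {f} (¬a , ¬b) → ¬Touches⇒VertexDisjoint f ¬a ¬b })
                  (¬Any⇒All¬ S.N S.end-free , ¬Any⇒All¬ S.N (S.keeps-free (left⇒right ab (altPath-left path)) b-free))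
                ∷ proj₂ S.matching

    longer : suc (length S.N) ≤ length M
    longer = proj₂ M-maximum _ (IsPairwiseMatching⇒IsMatching {G = H} augmented)

  mate-on-path-reachable : ∀ {a V b x} → AltPath a V → b ∈ᴸ V → EdgeIn b x M → Reachable x
  mate-on-path-reachable path@(step _ _ _ ba) (here refl) bx =
    subst Reachable (mate-unique (proj₂ M-matching) ba bx) (_ , path)
  mate-on-path-reachable (step path _ _ _) (there b∈V) bx = mate-on-path-reachable path b∈V bx

  mate-reachable : ∀ {a V b x} → AltPath a V → Adj H a b → EdgeIn b x M → Reachable x
  mate-reachable {V = V} {b} path ab bx with b ∈ᴸ? V
  ... | yes b∈V = mate-on-path-reachable path b∈V bx
  ... | no  b∉V = _ , step path ab b∉V bx

  InCover : Fin n → Set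
  InCover v = (Left v × ¬ Reachable v) ⊎ (Right v × ∃ λ a → Reachable a × Adj H a v)

  left⊎right : ∀ v → Left v ⊎ Right v
  left⊎right v with c v
  ... | false = inj₁ refl
  ... | true  = inj₂ refl

  InCover⇒Covered : ∀ {v} → InCover v → Covered v M
  InCover⇒Covered {v} v∈C = decidable-stable (any? (λ e → (v ≟ proj₁ e) ⊎-dec (v ≟ proj₂ e)) M) (not-free v∈C)
    where
    not-free : InCover v → ¬ ¬ Covered v M
    not-free (inj₁ (v-left , unreachable))   v-free = unreachable ([] , start v-left v-free)
    not-free (inj₂ (_ , _ , (_ , path) , av)) v-free = no-augmenting-path path av v-free

  left-mate-InCover : ∀ {x y} → Left x → EdgeIn y x M → InCover x → ¬ InCover y
  left-mate-InCover x-left _  (inj₂ (x-right , _))      _ = left≢right x-left x-right refl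
  left-mate-InCover x-left yx (inj₁ _) (inj₁ (y-left , _)) = proper (mate-adj yx) (trans y-left (≡.sym x-left))
  left-mate-InCover x-left yx (inj₁ (_ , unreachable)) (inj₂ (_ , _ , (_ , path) , ay)) =
    unreachable (mate-reachable path ay yx)

  mate-InCover : ∀ {x y} → EdgeIn x y M → InCover x → ¬ InCover y
  mate-InCover {x} xy with left⊎right x
  ... | inj₁ x-left  = left-mate-InCover x-left (EdgeIn-sym xy)
  ... | inj₂ x-right = flip (left-mate-InCover (right⇒left (mate-adj xy) x-right) xy)

  M-meets-cover-once : All (λ e → InCover (proj₁ e) → ¬ InCover (proj₂ e)) M
  M-meets-cover-once = All.tabulate λ xy∈M → mate-InCover (Any.map (inj₁ ∘ ≡.sym) xy∈M)

  left-edge-meets-cover : ∀ {u v} → Adj H u v → Left u → ¬ InCover u → ¬ InCover v → ⊥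
  left-edge-meets-cover {u} uv u-left u∉C v∉C =
    u∉C (inj₁ (u-left , λ u-reachable → v∉C (inj₂ (left⇒right uv u-left , u , u-reachable , uv))))

  edge-meets-cover : ∀ {u v} → Adj H u v → ¬ InCover u → ¬ InCover v → ⊥
  edge-meets-cover {u} uv u∉C v∉C with left⊎right u
  ... | inj₁ u-left  = left-edge-meets-cover uv u-left u∉C v∉C
  ... | inj₂ u-right = left-edge-meets-cover (Graph.sym H uv) (right⇒left uv u-right) v∉C u∉C

  vertexCover : ¬ ¬ (∃ λ C → IsVertexCover H C × ∣ C ∣ ≤ length M)
  vertexCover = do
    (C , C⇔InCover) ← ¬¬-comprehension InCover
    pure (C , certificate C C⇔InCover)
    where
    certificate : ∀ C → (∀ v → v ∈ C ⇔ InCover v) → IsVertexCover H C × ∣ C ∣ ≤ length M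
    certificate C C⇔InCover = cover , size
      where
      to : ∀ {v} → v ∈ C → InCover v
      to {v} = Equivalence.to (C⇔InCover v)

      from : ∀ {v} → InCover v → v ∈ C
      from {v} = Equivalence.from (C⇔InCover v)

      cover : IsVertexCover H C
      cover {u} {v} uv with u ∈? C | v ∈? C
      ... | yes u∈C | _       = inj₁ u∈C
      ... | no  _   | yes v∈C = inj₂ v∈C
      ... | no  u∉C | no  v∉C = ⊥-elim (edge-meets-cover uv (u∉C ∘ from) (v∉C ∘ from))

      size : ∣ C ∣ ≤ length M
      size = ∣C∣≤length C M (InCover⇒Covered ∘ to)
               (All.map (λ once x∈C y∈C → once (to x∈C) (to y∈C)) M-meets-cover-once)

König : ∀ {n} (H : Graph n) {M} → Bipartite H → IsMaximumMatching H M →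
        ¬ ¬ (∃ λ C → IsVertexCover H C × ∣ C ∣ ≤ length M)
König H (c , proper) M-maximum = AlternatingPaths.vertexCover H c proper M-maximum

n≤α+ν : ∀ {n} (H : Graph n) {M I} → Bipartite H → IsMaximumMatching H M → IsMaximumIndependent H I →
        n ≤ ∣ I ∣ + length M
n≤α+ν {n} H {M} {I} bipartite M-maximum (_ , I-maximum) = decidable-stable (n ≤? ∣ I ∣ + length M) do
  (C , C-cover , ∣C∣≤ν) ← König H bipartite M-maximum
  pure (begin
    n                ≡⟨ ∣∁p∣+∣p∣≡n C ⟨
    ∣ ∁ C ∣ + ∣ C ∣  ≤⟨ +-mono-≤ (I-maximum (∁ C) (∁-vertexCover-independent {G = H} C-cover)) ∣C∣≤ν ⟩
    ∣ I ∣ + length M ∎)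
  where open ≤-Reasoning

maximumMatching : ∀ {n} (H : Graph n) (bound : ℕ) → (∀ N → IsMatching H N → length N ≤ bound) →
                  ¬ ¬ (∃ (IsMaximumMatching H))
maximumMatching H bound bounded = ¬¬-maximum (IsMatching H) length bound bounded ([] , λ ())

peeling-bound : ∀ {n} {G : Graph n} {Ms N} → PeelingSequence G Ms → IsMatching (deleteAll G Ms) N →
                length Ms * length N ≤ length (concat Ms)
peeling-bound [] _ = z≤n
peeling-bound {G = G} {M ∷ Ms} {N} (M-maximum ∷ peeling) N-matching = begin
  length N + length Ms * length N   ≤⟨ +-mono-≤ (proj₂ M-maximum N (deleteAll-IsMatching G (M ∷ Ms) N-matching))
                                                (peeling-bound peeling N-matching) ⟩
  length M + length (concat Ms)     ≡⟨ length-++ M ⟨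
  length (M ++ concat Ms)           ∎
  where open ≤-Reasoning

lemma1 : (n : ℕ) (G : Graph n) → Bipartite G →
    (Ms : List (List (Edge n))) → length Ms ≥ 1 → PeelingSequence G Ms →
    (I : Subset n) → IsMaximumIndependent (deleteAll G Ms) I →
    length Ms * n ≤ length Ms * ∣ I ∣ + length (concat Ms)
lemma1 n G bipartite []        ()
lemma1 n G bipartite Ms@(M₁ ∷ _) _ peeling@(M₁-maximum ∷ _) I I-maximum =
  decidable-stable (k * n ≤? k * ∣ I ∣ + length (concat Ms)) do
    (M , M-maximum) ← maximumMatching Gₖ (length M₁) λ N N-matching →
                        proj₂ M₁-maximum N (deleteAll-IsMatching G Ms N-matching)
    pure (begin
      k * n                          ≤⟨ *-monoʳ-≤ k (n≤α+ν Gₖ (deleteAll-Bipartite G Ms bipartite) M-maximum I-maximum) ⟩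
      k * (∣ I ∣ + length M)         ≡⟨ *-distribˡ-+ k ∣ I ∣ (length M) ⟩
      k * ∣ I ∣ + k * length M       ≤⟨ +-monoʳ-≤ (k * ∣ I ∣) (peeling-bound peeling (proj₁ M-maximum)) ⟩
      k * ∣ I ∣ + length (concat Ms) ∎)
  where
  open ≤-Reasoning

  Gₖ : Graph n
  Gₖ = deleteAll G Ms

  k : ℕ
  k = length Ms
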